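{- Let $\mathcal{F}_1,\dots,\mathcal{F}_k$ be set systems over $[n_1],\dots,[n_k]$ respectively, let $\mathcal{F}=\mathcal{F}_1\uplus\cdots\uplus\mathcal{F}_k$ and $n=n_1+\dots+n_k$. If $\pi$ is a permutation of $[n]$ and $(\pi_1,\dots,\pi_k)$ is the $(n_1,\dots,n_k)$-induced split of $\pi$, then $\pi$ is supported by $\mathcal{F}$ if and only if $\pi_i$ is supported by $\mathcal{F}_i$ for all $1\le i\le k$.
   Context: A set system over $[m]$ is a family $\mathcal{F}\subseteq 2^{[m]}$. For a permutation $\pi$ of $[m]$ (a sequence $\pi(1),\dots,\pi(m)$), its prefix-sets are $\pi^{(0)}=\emptyset$ and $\pi^{(i)}=\{\pi(1),\dots,\pi(i)\}$; $\pi$ is supported by $\mathcal{F}$ if all its prefix-sets $\pi^{(0)},\dots,\pi^{(m)}$ belong to $\mathcal{F}$. The union product of $\mathcal{F}_1$ over $[n_1]$ and $\mathcal{F}_2$ over $[n_2]$ is $\mathcal{F}_1\uplus\mathcal{F}_2=\{s_1\cup(s_2+n_1): s_1\in\mathcal{F}_1,s_2\in\mathcal{F}_2\}$ over $[n_1+n_2]$, with $s_2+n_1=\{e+n_1:e\in s_2\}$; iterated products are taken left to right. For positive $n_1,n_2$ with $n_1+n_2=n$, the $(n_1,n_2)$-induced split of a permutation $\pi$ of $[n]$ is $(\pi_1,\pi_2)$ where $\pi_1$ is the sequence $\pi$ with all elements larger than $n_1$ deleted, and $\pi_2$ is the sequence $\pi$ with all elements $\le n_1$ deleted and $n_1$ subtracted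 from the remaining ones. For $k>2$ and positive $n_1,\dots,n_k$ summing to $n$, the $(n_1,\dots,n_k)$-induced split $(\pi_1,\dots,\pi_k)$ is defined recursively: let $(\pi',\pi_k)$ be the $(n_1+\dots+n_{k-1},n_k)$-induced split of $\pi$ and $(\pi_1,\dots,\pi_{k-1})$ the $(n_1,\dots,n_{k-1})$-induced split of $\pi'$. -}

module Defs where

open import Data.Nat using (ℕ; _+_; NonZero)
open import Data.Fin using (Fin; splitAt)
open import Data.Fin.Subset using (Subset; ⊥; ⁅_⁆; _∪_)
open import Data.Vec using (_++_)
open import Data.List using (List; foldr; take; length; mapMaybe; allFin)
open import Data.Maybe using (Maybe; just; nothing)
open import Data.Sum using (_⊎_; inj₁; inj₂)
open import Data.Product using (_×_; Σ; ∃; _,_)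
open import Data.Unit using (⊤)
open import Relation.Binary.PropositionalEquality using (_≡_)
open import Data.List.Relation.Binary.Permutation.Propositional using (_↭_)
import Data.Nat as ℕ

-- Ground set [m] is modelled as Fin m (0-indexed: element e of [m] is Fin value e-1).
-- A set system over [m]: a family of subsets of [m], i.e. a predicate on Subset m.
SetSystem : ℕ → Set₁
SetSystem m = Subset m → Set

-- A permutation of [m], as a sequence π(1),…,π(m): a list that is a
-- rearrangement of 0,…,m-1.
IsPermutation : ∀ {m} → List (Fin m) → Set
IsPermutation {m} π = π ↭ allFin m

elems : ∀ {m} → List (Fin m) → Subset m
elems = foldr (λ x s → ⁅ x ⁆ ∪ s) ⊥

prefixSet : ∀ {m} → List (Fin m) → ℕ → Subset m
prefixSet π i = elems (take i π)

SupportedBy : ∀ {m} → SetSystem m → List (Fin m) → Set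
SupportedBy 𝓕 π = ∀ i → i ℕ.≤ length π → 𝓕 (prefixSet π i)

-- union product: s1 ∪ (s2 + n1) is exactly the concatenation of characteristic vectors
_⊎ˢ_ : ∀ {n₁ n₂} → SetSystem n₁ → SetSystem n₂ → SetSystem (n₁ + n₂)
(𝓕₁ ⊎ˢ 𝓕₂) s = ∃ λ s₁ → ∃ λ s₂ → 𝓕₁ s₁ × 𝓕₂ s₂ × s ≡ s₁ ++ s₂

-- A nonempty sequence 𝓕₁,…,𝓕ₖ of set systems over [n₁],…,[nₖ], built as a
-- snoc-list; the index is n = n₁ + ⋯ + nₖ (associated to the left).
data Systems : ℕ → Set₁ where
  [_] : ∀ {n} → SetSystem n → Systems n
  _▷_ : ∀ {m n} → Systems m → SetSystem n → Systems (m + n)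

AllPositive : ∀ {n} → Systems n → Set
AllPositive ([_] {n} 𝓕) = NonZero n
AllPositive (_▷_ {n = n} 𝓢 𝓕) = AllPositive 𝓢 × NonZero n

⨄ : ∀ {n} → Systems n → SetSystem n
⨄ [ 𝓕 ] = 𝓕
⨄ (𝓢 ▷ 𝓕) = ⨄ 𝓢 ⊎ˢ 𝓕

left : ∀ {n₁ n₂} → List (Fin (n₁ + n₂)) → List (Fin n₁)
left {n₁} = mapMaybe (λ x → leftOf (splitAt n₁ x))
  where
  leftOf : ∀ {a b} → Fin a ⊎ Fin b → Maybe (Fin a)
  leftOf (inj₁ y) = just y
  leftOf (inj₂ _) = nothing

right : ∀ {n₁ n₂} → List (Fin (n₁ + n₂)) → List (Fin n₂)
right {n₁} = mapMaybe (λ x → rightOf (splitAt n₁ x))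
  where
  rightOf : ∀ {a b} → Fin a ⊎ Fin b → Maybe (Fin b)
  rightOf (inj₁ _) = nothing
  rightOf (inj₂ y) = just y

Tuple : ∀ {n} → Systems n → Set
Tuple ([_] {n} _) = List (Fin n)
Tuple (_▷_ {n = n} 𝓢 _) = Tuple 𝓢 × List (Fin n)

split : ∀ {n} (𝓢 : Systems n) → List (Fin n) → Tuple 𝓢
split [ _ ] π = π
split (_▷_ {m} {n} 𝓢 _) π = split 𝓢 (left {m} {n} π) , right {m} {n} π

AllSupported : ∀ {n} (𝓢 : Systems n) → Tuple 𝓢 → Set
AllSupported [ 𝓕 ] π = SupportedBy 𝓕 π
AllSupported (𝓢 ▷ 𝓕) (πs , πₖ) = AllSupported 𝓢 πs × SupportedBy 𝓕 πₖ

-- Taking prefixes commutes with the (n₁,n₂)-induced split: the two parts of a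
-- prefix of π are prefixes of the two parts of π, every prefix of a part arises
-- in this way, and the prefix-set of π, as a characteristic vector, is the
-- concatenation of the prefix-sets of the parts. As a vector over [n₁ + n₂]
-- decomposes uniquely as s₁ ++ s₂, a prefix-set of π lies in 𝓕₁ ⊎ˢ 𝓕₂ exactly
-- when the corresponding prefix-sets of the parts lie in 𝓕₁ and 𝓕₂.

module Submission where

open import Defs
open import Data.Nat using (ℕ; zero; suc; _+_; _≤_; z≤n; s≤s)
open import Data.Fin using (Fin; zero; suc; splitAt; _↑ˡ_; _↑ʳ_)
open import Data.Fin.Properties using (splitAt⁻¹-↑ˡ; splitAt⁻¹-↑ʳ)
open import Data.Fin.Subset using (Subset; ⊥; ⁅_⁆; _∪_)
open import Data.Fin.Subset.Properties using (∪-identityˡ)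
open import Data.List using (List; []; _∷_; take; length; map; catMaybes; mapMaybe)
open import Data.List.Properties using (take-map; length-map)
open import Data.Maybe using (Maybe; just; nothing)
open import Data.Product using (∃-syntax; _×_; _,_; proj₁; proj₂)
open import Data.Product.Function.NonDependent.Propositional using (_×-⇔_)
open import Data.Sum using (inj₁; inj₂)
open import Data.Vec using (_∷_; replicate; _++_)
open import Data.Vec.Properties using (++-injectiveˡ; ++-injectiveʳ; zipWith-++)
open import Function.Bundles using (_⇔_; mk⇔; Equivalence)
open import Function.Construct.Composition using (_⇔-∘_)
open import Function.Construct.Identity using (⇔-id)
open import Relation.Binary.PropositionalEquality
  using (_≡_; refl; sym; trans; cong; cong₂; subst)

module _ {B : Set} where

  catMaybes-take : ∀ i (ms : List (Maybe B)) →
    ∃[ j ] j ≤ length (catMaybes ms) × catMaybes (take i ms) ≡ take j (catMaybes ms)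
  catMaybes-take zero    ms             = 0 , z≤n , refl
  catMaybes-take (suc i) []             = 0 , z≤n , refl
  catMaybes-take (suc i) (just y ∷ ms)  with catMaybes-take i ms
  ... | j , j≤ , eq = suc j , s≤s j≤ , cong (y ∷_) eq
  catMaybes-take (suc i) (nothing ∷ ms) = catMaybes-take i ms

  take-catMaybes : ∀ j (ms : List (Maybe B)) → j ≤ length (catMaybes ms) →
    ∃[ i ] i ≤ length ms × catMaybes (take i ms) ≡ take j (catMaybes ms)
  take-catMaybes zero    ms             _        = 0 , z≤n , refl
  take-catMaybes (suc j) (just y ∷ ms)  (s≤s j≤) with take-catMaybes j ms j≤
  ... | i , i≤ , eq = suc i , s≤s i≤ , cong (y ∷_) eq
  take-catMaybes (suc j) (nothing ∷ ms) j<       with take-catMaybes (suc j) ms j<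
  ... | i , i≤ , eq = suc i , s≤s i≤ , eq

module _ {A B : Set} (f : A → Maybe B) where

  mapMaybe-take : ∀ i (xs : List A) →
    ∃[ j ] j ≤ length (mapMaybe f xs) × mapMaybe f (take i xs) ≡ take j (mapMaybe f xs)
  mapMaybe-take i xs with catMaybes-take i (map f xs)
  ... | j , j≤ , eq = j , j≤ , trans (cong catMaybes (sym (take-map {f = f} i xs))) eq

  take-mapMaybe : ∀ j (xs : List A) → j ≤ length (mapMaybe f xs) →
    ∃[ i ] i ≤ length xs × mapMaybe f (take i xs) ≡ take j (mapMaybe f xs)
  take-mapMaybe j xs j≤ with take-catMaybes j (map f xs) j≤
  ... | i , i≤ , eq =
    i , subst (i ≤_) (length-map f xs) i≤ , trans (cong catMaybes (sym (take-map {f = f} i xs))) eq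

++-replicate : ∀ {A : Set} m n (x : A) → replicate m x ++ replicate n x ≡ replicate (m + n) x
++-replicate zero    n x = refl
++-replicate (suc m) n x = cong (x ∷_) (++-replicate m n x)

⁅i↑ˡn⁆≡⁅i⁆++⊥ : ∀ {m} n (i : Fin m) → ⁅ i ↑ˡ n ⁆ ≡ ⁅ i ⁆ ++ ⊥
⁅i↑ˡn⁆≡⁅i⁆++⊥ {suc m} n zero    = cong (_ ∷_) (sym (++-replicate m n _))
⁅i↑ˡn⁆≡⁅i⁆++⊥         n (suc i) = cong (_ ∷_) (⁅i↑ˡn⁆≡⁅i⁆++⊥ n i)

⁅m↑ʳi⁆≡⊥++⁅i⁆ : ∀ m {n} (i : Fin n) → ⁅ m ↑ʳ i ⁆ ≡ ⊥ ++ ⁅ i ⁆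
⁅m↑ʳi⁆≡⊥++⁅i⁆ zero    i = refl
⁅m↑ʳi⁆≡⊥++⁅i⁆ (suc m) i = cong (_ ∷_) (⁅m↑ʳi⁆≡⊥++⁅i⁆ m i)

module _ {m n : ℕ} where

  ++⊥-∪-++ : (p r : Subset m) (s : Subset n) → (p ++ ⊥) ∪ (r ++ s) ≡ (p ∪ r) ++ s
  ++⊥-∪-++ p r s = trans (zipWith-++ _ p ⊥ r s) (cong ((p ∪ r) ++_) (∪-identityˡ s))

  ⊥++-∪-++ : (q : Subset n) (r : Subset m) (s : Subset n) → (⊥ ++ q) ∪ (r ++ s) ≡ r ++ (q ∪ s)
  ⊥++-∪-++ q r s = trans (zipWith-++ _ ⊥ q r s) (cong (_++ (q ∪ s)) (∪-identityˡ r))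

  elems-left-right : (π : List (Fin (m + n))) →
                     elems π ≡ elems (left {m} {n} π) ++ elems (right {m} {n} π)
  elems-left-right []      = sym (++-replicate m n _)
  elems-left-right (x ∷ π) with splitAt m x in eq
  ... | inj₁ i = trans (cong₂ _∪_ ⁅x⁆≡⁅i⁆++⊥ (elems-left-right π)) (++⊥-∪-++ ⁅ i ⁆ _ _)
    where
    ⁅x⁆≡⁅i⁆++⊥ : ⁅ x ⁆ ≡ ⁅ i ⁆ ++ ⊥
    ⁅x⁆≡⁅i⁆++⊥ = trans (cong ⁅_⁆ (sym (splitAt⁻¹-↑ˡ eq))) (⁅i↑ˡn⁆≡⁅i⁆++⊥ n i)
  ... | inj₂ i = trans (cong₂ _∪_ ⁅x⁆≡⊥++⁅i⁆ (elems-left-right π)) (⊥++-∪-++ ⁅ i ⁆ _ _)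
    where
    ⁅x⁆≡⊥++⁅i⁆ : ⁅ x ⁆ ≡ ⊥ ++ ⁅ i ⁆
    ⁅x⁆≡⊥++⁅i⁆ = trans (cong ⁅_⁆ (sym (splitAt⁻¹-↑ʳ eq))) (⁅m↑ʳi⁆≡⊥++⁅i⁆ m i)

module _ {m n : ℕ} (𝓕₁ : SetSystem m) (𝓕₂ : SetSystem n) where

  ⊎ˢ⇔ : ∀ {s s₁ s₂} → s ≡ s₁ ++ s₂ → (𝓕₁ ⊎ˢ 𝓕₂) s ⇔ (𝓕₁ s₁ × 𝓕₂ s₂)
  ⊎ˢ⇔ {s} {s₁} {s₂} s≡ = mk⇔ to from
    where
    to : (𝓕₁ ⊎ˢ 𝓕₂) s → 𝓕₁ s₁ × 𝓕₂ s₂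
    to (t₁ , t₂ , 𝓕₁t₁ , 𝓕₂t₂ , s≡t) =
      subst 𝓕₁ (++-injectiveˡ t₁ s₁ t≡) 𝓕₁t₁ , subst 𝓕₂ (++-injectiveʳ t₁ s₁ t≡) 𝓕₂t₂
      where
      t≡ : t₁ ++ t₂ ≡ s₁ ++ s₂
      t≡ = trans (sym s≡t) s≡
    from : 𝓕₁ s₁ × 𝓕₂ s₂ → (𝓕₁ ⊎ˢ 𝓕₂) s
    from (𝓕₁s₁ , 𝓕₂s₂) = s₁ , s₂ , 𝓕₁s₁ , 𝓕₂s₂ , s≡

  ⊎ˢ-prefixSet⇔ : (π : List (Fin (m + n))) (i : ℕ) →
    (𝓕₁ ⊎ˢ 𝓕₂) (prefixSet π i) ⇔
    (𝓕₁ (elems (left {m} {n} (take i π))) × 𝓕₂ (elems (right {m} {n} (take i π))))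
  ⊎ˢ-prefixSet⇔ π i = ⊎ˢ⇔ (elems-left-right (take i π))

  SupportedBy-⊎ˢ : (π : List (Fin (m + n))) →
    SupportedBy (𝓕₁ ⊎ˢ 𝓕₂) π ⇔ (SupportedBy 𝓕₁ (left {m} {n} π) × SupportedBy 𝓕₂ (right {m} {n} π))
  SupportedBy-⊎ˢ π = mk⇔ to from
    where
    to : SupportedBy (𝓕₁ ⊎ˢ 𝓕₂) π →
         SupportedBy 𝓕₁ (left {m} {n} π) × SupportedBy 𝓕₂ (right {m} {n} π)
    to supp = supp₁ , supp₂
      where
      components : ∀ i → i ≤ length π →
        𝓕₁ (elems (left {m} {n} (take i π))) × 𝓕₂ (elems (right {m} {n} (take i π)))
      components i i≤ = Equivalence.to (⊎ˢ-prefixSet⇔ π i) (supp i i≤)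
      supp₁ : SupportedBy 𝓕₁ (left {m} {n} π)
      supp₁ j j≤ with take-mapMaybe _ j π j≤
      ... | i , i≤ , eq = subst 𝓕₁ (cong elems eq) (proj₁ (components i i≤))
      supp₂ : SupportedBy 𝓕₂ (right {m} {n} π)
      supp₂ j j≤ with take-mapMaybe _ j π j≤
      ... | i , i≤ , eq = subst 𝓕₂ (cong elems eq) (proj₂ (components i i≤))
    from : SupportedBy 𝓕₁ (left {m} {n} π) × SupportedBy 𝓕₂ (right {m} {n} π) →
           SupportedBy (𝓕₁ ⊎ˢ 𝓕₂) π
    from (supp₁ , supp₂) i _ with mapMaybe-take _ i π | mapMaybe-take _ i π
    ... | j , j≤ , eq₁ | k , k≤ , eq₂ = Equivalence.from (⊎ˢ-prefixSet⇔ π i)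
      (subst 𝓕₁ (cong elems (sym eq₁)) (supp₁ j j≤) , subst 𝓕₂ (cong elems (sym eq₂)) (supp₂ k k≤))

SupportedBy-⨄ : ∀ {n} (𝓢 : Systems n) (π : List (Fin n)) →
  SupportedBy (⨄ 𝓢) π ⇔ AllSupported 𝓢 (split 𝓢 π)
SupportedBy-⨄ [ 𝓕 ]             π = ⇔-id _
SupportedBy-⨄ (_▷_ {m} {n} 𝓢 𝓕) π =
  (SupportedBy-⨄ 𝓢 (left {m} {n} π) ×-⇔ ⇔-id _) ⇔-∘ SupportedBy-⊎ˢ (⨄ 𝓢) 𝓕 π

lemma3p9 : ∀ {n} (𝓢 : Systems n) → AllPositive 𝓢 →
           (π : List (Fin n)) → IsPermutation π →
           SupportedBy (⨄ 𝓢) π ⇔ AllSupported 𝓢 (split 𝓢 π)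
lemma3p9 𝓢 _ π _ = SupportedBy-⨄ 𝓢 π
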